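{- With $\alpha=1+\sqrt2$ and $\beta=1-\sqrt2$, for all $n\geq 1$: $$B_{n}^{neobc}=\frac{3(\alpha^{4n-1}+\beta^{4n-1})+6}{8},\quad C_{n}^{neobc}=\frac{3(\alpha^{4n-1}-\beta^{4n-1})}{2\sqrt{2}},$$ $$R_{n}^{neobc}=\frac{3(\alpha^{4n-2}+\beta^{4n-2})-10}{8},\quad CR_{n}^{neobc}=\frac{3(\alpha^{4n-2}-\beta^{4n-2})}{4\sqrt{2}}.$$
   Context: A positive integer $m$ is a neo balcobalancing number if there is a positive integer $r$ (its neo balcobalancer) such that $(1+2+\cdots+(m-1))+(1+2+\cdots+m)=2[(m-1)+m+(m+1)+(m+2)+\cdots+(m+r)]$; then $r=\frac{ -2m-1+\sqrt{8m^2-12m+9}}{2}$ (equivalently, $m$ is a neo balcobalancing number iff $8m^2-12m+9$ is a perfect square). $B_n^{neobc}$ denotes the $n$-th neo balcobalancing number in increasing order ($n\ge1$), $R_n^{neobc}$ its neo balcobalancer, $C_n^{neobc}=\sqrt{8(B_n^{neobc})^2-12B_n^{neobc}+9}$ and $CR_n^{neobc}=\sqrt{2(R_n^{neobc})^2+5R_n^{neobc}+2}$. -}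

module Defs where

open import Data.Nat as ℕ using (ℕ; zero; suc; _∸_; _<_)
open import Data.Integer as ℤ using (ℤ; +_; -_)
open import Data.List using (List; length)
open import Data.List.Relation.Unary.All using (All)
open import Data.List.Relation.Unary.Linked using (Linked)
open import Data.List.Membership.Propositional using (_∈_)
open import Data.Product using (Σ; _×_; ∃)
open import Relation.Binary.PropositionalEquality using (_≡_)

tri : ℕ → ℕ
tri zero = 0
tri (suc n) = suc n ℕ.+ tri n

sumFrom : ℕ → ℕ → ℕ
sumFrom a zero = 0
sumFrom a (suc len) = a ℕ.+ sumFrom (suc a) len

IsNeoBalcobalancer : ℕ → ℕ → Set
IsNeoBalcobalancer m r =
  (0 < r) × (tri (m ∸ 1) ℕ.+ tri m ≡ 2 ℕ.* sumFrom (m ∸ 1) (r ℕ.+ 2))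

NeoBC : ℕ → Set
NeoBC m = (0 < m) × ∃ λ r → IsNeoBalcobalancer m r

-- m is the n-th (n ≥ 1, written n = suc k) neo balcobalancing number in
-- increasing order: m is one, and the neo balcobalancing numbers below m
-- form a strictly increasing list of length k.
IsNthNeoBC : ℕ → ℕ → Set
IsNthNeoBC k m = NeoBC m × Σ (List ℕ) λ xs →
  Linked _<_ xs × All NeoBC xs × All (_< m) xs ×
  (∀ j → j < m → NeoBC j → j ∈ xs) × (length xs ≡ k)

-- The ring ℤ[√2]: ⟨ a , b ⟩ represents a + b√2
record ℤ√2 : Set where
  constructor ⟨_,_⟩
  field
    re : ℤ
    im : ℤ

infixl 6 _⊕_ _⊖_
infixl 7 _⊗_

_⊕_ : ℤ√2 → ℤ√2 → ℤ√2
⟨ a , b ⟩ ⊕ ⟨ c , d ⟩ = ⟨ a ℤ.+ c , b ℤ.+ d ⟩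

_⊖_ : ℤ√2 → ℤ√2 → ℤ√2
⟨ a , b ⟩ ⊖ ⟨ c , d ⟩ = ⟨ a ℤ.- c , b ℤ.- d ⟩

_⊗_ : ℤ√2 → ℤ√2 → ℤ√2
⟨ a , b ⟩ ⊗ ⟨ c , d ⟩ = ⟨ a ℤ.* c ℤ.+ + 2 ℤ.* b ℤ.* d , a ℤ.* d ℤ.+ b ℤ.* c ⟩

ι : ℤ → ℤ√2
ι a = ⟨ a , + 0 ⟩

√2 : ℤ√2
√2 = ⟨ + 0 , + 1 ⟩

_^_ : ℤ√2 → ℕ → ℤ√2
x ^ zero = ι (+ 1)
x ^ suc n = x ⊗ (x ^ n)

α β : ℤ√2
α = ⟨ + 1 , + 1 ⟩
β = ⟨ + 1 , - (+ 1) ⟩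

-- Writing m = t + 1 and r for its balancer, the defining equation becomes x² + 9 = 2y² with
-- x = 4t + 1 and y = 2t + 2r + 3 = C. Multiplication of x + y√2 by the unit α⁴ = 17 + 12√2
-- preserves this equation and the condition x ≡ 1 mod 4; conversely every solution with t ≥ 13
-- is the image of a smaller one, and a finite search leaves only 21 + 15√2 = 3α³ below that.
-- So the solutions are exactly x + y√2 = 3α^(4k+3), and B, R, C and CR are linear in the
-- coordinates of α^(4k+2) = (4v + 3) + 2w√2.

module Submission where

open import Defs
open import Data.Nat using (ℕ; suc; _∸_; _*_)
open import Data.Integer using (+_)
open import Data.Product using (Σ; _×_)
open import Relation.Binary.PropositionalEquality using (_≡_)

open import Data.Nat using (zero; _+_; _<_; _≤_; z≤n; s≤s; _≟_; _<?_)
open import Data.Nat.Properties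
open import Data.Nat.Induction using (<-rec)
open import Data.Nat.Tactic.RingSolver using (solve)
open import Data.Integer as ℤ using (ℤ; -_)
import Data.Integer.Properties as ℤₚ
import Data.Integer.Tactic.RingSolver as ℤ-Solver
open import Data.List using ([]; _∷_; applyUpTo)
open import Data.List.Properties using (length-applyUpTo)
open import Data.List.Membership.Propositional.Properties using (∈-applyUpTo⁺)
import Data.List.Relation.Unary.All.Properties as All
import Data.List.Relation.Unary.Linked.Properties as Linked
open import Data.Product using (_,_; ∃; ∃₂; uncurry)
open import Data.Sum using (inj₁; inj₂)
open import Data.Empty using (⊥-elim)
open import Relation.Binary.Definitions using (tri<; tri≈; tri>)
open import Data.List.Membership.Propositional using (_∈_)
open import Function.Base using (case_of_)
open import Function.Bundles using (_⇔_; mk⇔; Equivalence)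
import Function.Properties.Equivalence as ⇔
open import Relation.Binary.PropositionalEquality
  using (refl; sym; trans; cong; cong₂; subst; subst₂; module ≡-Reasoning)
open import Relation.Nullary using (yes; no)
open import Relation.Nullary.Decidable using (toWitness; _→-dec_; _×-dec_)

+-cancelʳ-≡′ : ∀ {a b c d} → a + c ≡ b + d → c ≡ d → a ≡ b
+-cancelʳ-≡′ {a} {b} {c} eq refl = +-cancelʳ-≡ c a b eq

+-cancelˡ-≡′ : ∀ {a b c d} → a + c ≡ b + d → a ≡ b → c ≡ d
+-cancelˡ-≡′ {a} {c = c} {d} eq refl = +-cancelˡ-≡ a c d eq

2*tri≡n*[1+n] : ∀ n → 2 * tri n ≡ n * suc n
2*tri≡n*[1+n] zero = refl
2*tri≡n*[1+n] (suc n) = begin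
  2 * (suc n + tri n)    ≡⟨ *-distribˡ-+ 2 (suc n) (tri n) ⟩
  2 * suc n + 2 * tri n  ≡⟨ cong (_+_ (2 * suc n)) (2*tri≡n*[1+n] n) ⟩
  2 * suc n + n * suc n  ≡⟨ solve (n ∷ []) ⟩
  suc n * suc (suc n)    ∎
  where open ≡-Reasoning

tri+tri≡square : ∀ n → tri n + tri (suc n) ≡ suc n * suc n
tri+tri≡square n with tri n | 2*tri≡n*[1+n] n
... | T | 2T≡n[n+1] = begin
  T + (suc n + T)    ≡⟨ solve (n ∷ T ∷ []) ⟩
  suc n + 2 * T      ≡⟨ cong (_+_ (suc n)) 2T≡n[n+1] ⟩
  suc n + n * suc n  ∎
  where open ≡-Reasoning

sumFrom-closed : ∀ a n → 2 * sumFrom a n + n ≡ n * (2 * a + n)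
sumFrom-closed a zero = refl
sumFrom-closed a (suc n) with sumFrom (suc a) n | sumFrom-closed (suc a) n
... | S | 2S+n≡ = begin
  2 * (a + S) + suc n                ≡⟨ solve (a ∷ n ∷ S ∷ []) ⟩
  (2 * S + n) + suc (2 * a)          ≡⟨ cong (λ z → z + suc (2 * a)) 2S+n≡ ⟩
  n * (2 * suc a + n) + suc (2 * a)  ≡⟨ solve (a ∷ n ∷ []) ⟩
  suc n * (2 * a + suc n)            ∎
  where open ≡-Reasoning

-- The equation x² + 9 = 2y²

Pell₉ : ℕ → ℕ → Set
Pell₉ x y = x * x + 9 ≡ 2 * y * y

neoBalance⇔square : ∀ t r →
  (tri t + tri (suc t) ≡ 2 * sumFrom t (r + 2)) ⇔ (suc t * suc t + (r + 2) ≡ (r + 2) * (2 * t + (r + 2)))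
neoBalance⇔square t r = mk⇔
  (λ balance → trans (cong (_+ (r + 2)) (trans (sym (tri+tri≡square t)) balance)) (sumFrom-closed t (r + 2)))
  (λ square → trans (tri+tri≡square t) (+-cancelʳ-≡ (r + 2) _ _ (trans square (sym (sumFrom-closed t (r + 2))))))

-- For m = t + 1 and x = 4m − 3 we have (x² + 9)/2 = 8m² − 12m + 9, so y is the paper's C.
square⇔pell₉ : ∀ t r →
  (suc t * suc t + (r + 2) ≡ (r + 2) * (2 * t + (r + 2))) ⇔ Pell₉ (1 + 4 * t) (2 * t + 2 * r + 3)
square⇔pell₉ t r = mk⇔
  (λ square → +-cancelʳ-≡′ identity (cong (8 *_) (sym square)))
  (λ pell → sym (*-cancelˡ-≡ _ _ 8 (+-cancelˡ-≡′ identity pell)))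
  where
  identity : (1 + 4 * t) * (1 + 4 * t) + 9 + 8 * ((r + 2) * (2 * t + (r + 2)))
           ≡ 2 * (2 * t + 2 * r + 3) * (2 * t + 2 * r + 3) + 8 * (suc t * suc t + (r + 2))
  identity = solve (t ∷ r ∷ [])

neoBalance⇔pell₉ : ∀ t r →
  (tri t + tri (suc t) ≡ 2 * sumFrom t (r + 2)) ⇔ Pell₉ (1 + 4 * t) (2 * t + 2 * r + 3)
neoBalance⇔pell₉ t r = ⇔.trans (neoBalance⇔square t r) (square⇔pell₉ t r)

pell₉⇒y≤x+3 : ∀ {x y} → Pell₉ x y → y ≤ x + 3
pell₉⇒y≤x+3 {x} {y} pell = ≮⇒≥ λ x+3<y → <-irrefl refl (begin-strict
  (x + 3) * (x + 3)  <⟨ *-mono-< x+3<y x+3<y ⟩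
  y * y              ≤⟨ *-monoˡ-≤ y (m≤m+n y (y + 0)) ⟩
  2 * y * y          ≡⟨ pell ⟨
  x * x + 9          ≤⟨ m≤m+n (x * x + 9) (6 * x) ⟩
  x * x + 9 + 6 * x  ≡⟨ solve (x ∷ []) ⟩
  (x + 3) * (x + 3)  ∎)
  where open ≤-Reasoning

pell₉⇒12x≤17y : ∀ {x y} → Pell₉ x y → 12 * x ≤ 17 * y
pell₉⇒12x≤17y {x} {y} pell = ≮⇒≥ λ 17y<12x → <-irrefl refl (begin-strict
  578 * (y * y)            ≡⟨ solve (y ∷ []) ⟩
  2 * (17 * y * (17 * y))  <⟨ *-monoʳ-< 2 (*-mono-< 17y<12x 17y<12x) ⟩
  2 * (12 * x * (12 * x))  ≡⟨ solve (x ∷ []) ⟩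
  288 * (x * x)            ≤⟨ m≤m+n (288 * (x * x)) 2592 ⟩
  288 * (x * x) + 2592     ≡⟨ solve (x ∷ []) ⟩
  288 * (x * x + 9)        ≡⟨ cong (288 *_) pell ⟩
  288 * (2 * y * y)        ≡⟨ solve (y ∷ []) ⟩
  576 * (y * y)            ≤⟨ *-monoˡ-≤ (y * y) (m≤m+n 576 2) ⟩
  578 * (y * y)            ∎)
  where open ≤-Reasoning

pell₉⇒24y<17x : ∀ {x y} → 51 ≤ x → Pell₉ x y → 24 * y < 17 * x
pell₉⇒24y<17x {x} {y} 51≤x pell = ≰⇒> λ 17x≤24y → <-irrefl refl (begin-strict
  288 * (x * x) + 2592     <⟨ +-monoʳ-< (288 * (x * x)) (≤-trans (m≤m+n 2593 8) (*-mono-≤ 51≤x 51≤x)) ⟩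
  288 * (x * x) + x * x    ≡⟨ solve (x ∷ []) ⟩
  17 * x * (17 * x)        ≤⟨ *-mono-≤ 17x≤24y 17x≤24y ⟩
  24 * y * (24 * y)        ≡⟨ solve (y ∷ []) ⟩
  288 * (2 * y * y)        ≡⟨ cong (288 *_) pell ⟨
  288 * (x * x + 9)        ≡⟨ solve (x ∷ []) ⟩
  288 * (x * x) + 2592     ∎)
  where open ≤-Reasoning

-- Multiplication of x + y√2 by 17 + 12√2 = α⁴, written in the coordinate t of x = 1 + 4t
-- (possible since 17 ≡ 1 mod 4).
pell₉-grow⇔ : ∀ t y → Pell₉ (1 + 4 * t) y ⇔ Pell₉ (1 + 4 * (17 * t + 6 * y + 4)) (48 * t + 17 * y + 12)
pell₉-grow⇔ t y = mk⇔
  (λ pell → +-cancelʳ-≡′ norm-invariant (sym pell))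
  (λ pell → sym (+-cancelˡ-≡′ norm-invariant pell))
  where
  norm-invariant : (1 + 4 * (17 * t + 6 * y + 4)) * (1 + 4 * (17 * t + 6 * y + 4)) + 9 + 2 * y * y
                 ≡ 2 * (48 * t + 17 * y + 12) * (48 * t + 17 * y + 12) + ((1 + 4 * t) * (1 + 4 * t) + 9)
  norm-invariant = solve (t ∷ y ∷ [])

grow-inverse : ∀ {t y} → 6 * y ≤ 17 * t + 4 → 48 * t + 12 ≤ 17 * y →
               ∃₂ λ t′ y′ → t ≡ 17 * t′ + 6 * y′ + 4 × y ≡ 48 * t′ + 17 * y′ + 12
grow-inverse {t} {y} 6y≤ 48t+12≤ with m≤n⇒∃[o]m+o≡n 6y≤ | m≤n⇒∃[o]m+o≡n 48t+12≤
... | t′ , 6y+t′≡ | y′ , 48t+12+y′≡ = t′ , y′ , t≡ , y≡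
  where
  open ≡-Reasoning
  t≡ : t ≡ 17 * t′ + 6 * y′ + 4
  t≡ = +-cancelʳ-≡ (288 * t + 102 * y + 68) t _ (begin
    t + (288 * t + 102 * y + 68)                  ≡⟨ solve (t ∷ y ∷ []) ⟩
    17 * (17 * t + 4) + 6 * (17 * y)              ≡⟨ cong₂ (λ a b → 17 * a + 6 * b) 6y+t′≡ 48t+12+y′≡ ⟨
    17 * (6 * y + t′) + 6 * (48 * t + 12 + y′)    ≡⟨ solve (t ∷ y ∷ t′ ∷ y′ ∷ []) ⟩
    (17 * t′ + 6 * y′ + 4) + (288 * t + 102 * y + 68)        ∎)
  y≡ : y ≡ 48 * t′ + 17 * y′ + 12
  y≡ = +-cancelʳ-≡ (816 * t + 288 * y + 192) y _ (begin
    y + (816 * t + 288 * y + 192)                 ≡⟨ solve (t ∷ y ∷ []) ⟩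
    48 * (17 * t + 4) + 17 * (17 * y)             ≡⟨ cong₂ (λ a b → 48 * a + 17 * b) 6y+t′≡ 48t+12+y′≡ ⟨
    48 * (6 * y + t′) + 17 * (48 * t + 12 + y′)   ≡⟨ solve (t ∷ y ∷ t′ ∷ y′ ∷ []) ⟩
    (48 * t′ + 17 * y′ + 12) + (816 * t + 288 * y + 192)       ∎)

pell₉-growable : ∀ {t y} → 13 ≤ t → Pell₉ (1 + 4 * t) y → 6 * y ≤ 17 * t + 4 × 48 * t + 12 ≤ 17 * y
pell₉-growable {t} {y} 13≤t pell = 6y≤ , 48t+12≤
  where
  open ≤-Reasoning
  6y≤ : 6 * y ≤ 17 * t + 4
  6y≤ = *-cancelˡ-≤ 4 (≤-pred (begin-strict
    4 * (6 * y)             ≡⟨ solve (y ∷ []) ⟩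
    24 * y                  <⟨ pell₉⇒24y<17x {1 + 4 * t} {y} (≤-trans (m≤m+n 51 2) (s≤s (*-monoʳ-≤ 4 13≤t))) pell ⟩
    17 * (1 + 4 * t)        ≡⟨ solve (t ∷ []) ⟩
    suc (4 * (17 * t + 4))  ∎))
  48t+12≤ : 48 * t + 12 ≤ 17 * y
  48t+12≤ = begin
    48 * t + 12       ≡⟨ solve (t ∷ []) ⟩
    12 * (1 + 4 * t)  ≤⟨ pell₉⇒12x≤17y {1 + 4 * t} {y} pell ⟩
    17 * y            ∎

n<17n+6m+4 : ∀ n m → n < 17 * n + 6 * m + 4
n<17n+6m+4 n m = begin-strict
  n                                ≤⟨ m≤m+n n (16 * n + 6 * m + 3) ⟩
  n + (16 * n + 6 * m + 3)         <⟨ n<1+n _ ⟩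
  suc (n + (16 * n + 6 * m + 3))   ≡⟨ solve (n ∷ m ∷ []) ⟩
  17 * n + 6 * m + 4               ∎
  where open ≤-Reasoning

pell₉-shrink : ∀ {t y} → 13 ≤ t → Pell₉ (1 + 4 * t) y →
  ∃₂ λ t′ y′ → t′ < t × Pell₉ (1 + 4 * t′) y′ × t ≡ 17 * t′ + 6 * y′ + 4 × y ≡ 48 * t′ + 17 * y′ + 12
pell₉-shrink {t} {y} 13≤t pell =
  let t′ , y′ , t≡ , y≡ = uncurry (grow-inverse {t} {y}) (pell₉-growable {t} {y} 13≤t pell)
  in  t′ , y′
    , <-≤-trans (n<17n+6m+4 t′ y′) (≤-reflexive (sym t≡))
    , Equivalence.from (pell₉-grow⇔ t′ y′) (subst₂ (λ t y → Pell₉ (1 + 4 * t) y) t≡ y≡ pell)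
    , t≡ , y≡

pell₉-small : ∀ {t} → t < 13 → ∀ {y} → y < suc (1 + 4 * t + 3) → Pell₉ (1 + 4 * t) y → t ≡ 5 × y ≡ 15
pell₉-small = toWitness {a? = allUpTo? (λ t → allUpTo? (λ y →
  ((1 + 4 * t) * (1 + 4 * t) + 9 ≟ 2 * y * y) →-dec (t ≟ 5 ×-dec y ≟ 15)) (suc (1 + 4 * t + 3))) 13} _

pell₉⇒C² : ∀ {t c} → Pell₉ (1 + 4 * t) c → c * c + 12 * suc t ≡ 8 * suc t * suc t + 9
pell₉⇒C² {t} {c} pell = *-cancelˡ-≡ _ _ 2 (+-cancelʳ-≡′ identity pell)
  where
  identity : 2 * (c * c + 12 * suc t) + ((1 + 4 * t) * (1 + 4 * t) + 9) ≡ 2 * (8 * suc t * suc t + 9) + 2 * c * c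
  identity = solve (t ∷ c ∷ [])

pell₉⇒CR² : ∀ {c r} → Pell₉ (1 + 4 * (c + r + 1)) (2 * (c + r + 1) + 2 * r + 3) → c * c ≡ 2 * r * r + 5 * r + 2
pell₉⇒CR² {c} {r} pell = *-cancelˡ-≡ _ _ 8 (+-cancelʳ-≡′ identity (sym pell))
  where
  identity : 8 * (c * c) + 2 * (2 * (c + r + 1) + 2 * r + 3) * (2 * (c + r + 1) + 2 * r + 3)
           ≡ 8 * (2 * r * r + 5 * r + 2) + ((1 + 4 * (c + r + 1)) * (1 + 4 * (c + r + 1)) + 9)
  identity = solve (c ∷ r ∷ [])

-- The neo balcobalancing numbers

-- α ^ (4k + 2) = (4 v k + 3) + 2 w k √2; the recursion is multiplication by α⁴ = 17 + 12√2.
v w : ℕ → ℕ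
v zero = 0
v (suc k) = 17 * v k + 12 * w k + 12
w zero = 1
w (suc k) = 24 * v k + 17 * w k + 18

-- The data of B_{k+1} (indices are shifted by one from the paper's n ≥ 1); neoT k = B − 1.
neoT neoB neoR neoC neoCR : ℕ → ℕ
neoT k = 2 + 3 * v k + 3 * w k
neoB k = suc (neoT k)
neoR k = 1 + 3 * v k
neoC k = 9 + 12 * v k + 6 * w k
neoCR k = 3 * w k

neoT-suc : ∀ k → neoT (suc k) ≡ 17 * neoT k + 6 * neoC k + 4
neoT-suc k with v k | w k
... | a | b = solve (a ∷ b ∷ [])

neoC-suc : ∀ k → neoC (suc k) ≡ 48 * neoT k + 17 * neoC k + 12
neoC-suc k with v k | w k
... | a | b = solve (a ∷ b ∷ [])

pell₉-neo : ∀ k → Pell₉ (1 + 4 * neoT k) (neoC k)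
pell₉-neo zero = refl
pell₉-neo (suc k) = subst₂ (λ t y → Pell₉ (1 + 4 * t) y) (sym (neoT-suc k)) (sym (neoC-suc k))
  (Equivalence.to (pell₉-grow⇔ (neoT k) (neoC k)) (pell₉-neo k))

OnNeoOrbit : ℕ → ℕ → Set
OnNeoOrbit t y = ∃ λ k → t ≡ neoT k × y ≡ neoC k

neoOrbit-grow : ∀ {t y t′ y′} → t ≡ 17 * t′ + 6 * y′ + 4 → y ≡ 48 * t′ + 17 * y′ + 12 →
                OnNeoOrbit t′ y′ → OnNeoOrbit t y
neoOrbit-grow t≡ y≡ (k , refl , refl) = suc k , trans t≡ (sym (neoT-suc k)) , trans y≡ (sym (neoC-suc k))

pell₉⇒onNeoOrbit : ∀ t {y} → Pell₉ (1 + 4 * t) y → OnNeoOrbit t y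
pell₉⇒onNeoOrbit = <-rec _ descend
  where
  descend : ∀ t → (∀ {t′} → t′ < t → ∀ {y} → Pell₉ (1 + 4 * t′) y → OnNeoOrbit t′ y) →
            ∀ {y} → Pell₉ (1 + 4 * t) y → OnNeoOrbit t y
  descend t rec {y} pell = case t <? 13 of λ where
    (yes t<13) → 0 , pell₉-small t<13 (s≤s (pell₉⇒y≤x+3 {1 + 4 * t} {y} pell)) pell
    (no t≮13) → case pell₉-shrink {t} {y} (≮⇒≥ t≮13) pell of λ where
      (t′ , y′ , t′<t , pell′ , t≡ , y≡) → neoOrbit-grow {t′ = t′} {y′} t≡ y≡ (rec t′<t {y′} pell′)

neoC≡2T+2R+3 : ∀ k → neoC k ≡ 2 * neoT k + 2 * neoR k + 3
neoC≡2T+2R+3 k with v k | w k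
... | a | b = solve (a ∷ b ∷ [])

neoT≡CR+R+1 : ∀ k → neoT k ≡ neoCR k + neoR k + 1
neoT≡CR+R+1 k with v k | w k
... | a | b = solve (a ∷ b ∷ [])

pell₉-neoR : ∀ k → Pell₉ (1 + 4 * neoT k) (2 * neoT k + 2 * neoR k + 3)
pell₉-neoR k = subst (Pell₉ (1 + 4 * neoT k)) (neoC≡2T+2R+3 k) (pell₉-neo k)

neoR-isNeoBalcobalancer : ∀ k → IsNeoBalcobalancer (neoB k) (neoR k)
neoR-isNeoBalcobalancer k = s≤s z≤n , Equivalence.from (neoBalance⇔pell₉ (neoT k) (neoR k)) (pell₉-neoR k)

neoB-isNeoBC : ∀ k → NeoBC (neoB k)
neoB-isNeoBC k = s≤s z≤n , neoR k , neoR-isNeoBalcobalancer k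

neoBC⇒≡neoB : ∀ {m} → NeoBC m → ∃ λ k → m ≡ neoB k
neoBC⇒≡neoB {suc t} (_ , r , _ , balance) =
  case pell₉⇒onNeoOrbit t {2 * t + 2 * r + 3} (Equivalence.to (neoBalance⇔pell₉ t r) balance) of λ where
    (k , t≡ , _) → k , cong suc t≡

neoB-<-suc : ∀ k → neoB k < neoB (suc k)
neoB-<-suc k = s≤s (subst (neoT k <_) (sym (neoT-suc k)) (n<17n+6m+4 (neoT k) (neoC k)))

neoB-strictMono : ∀ {i j} → i < j → neoB i < neoB j
neoB-strictMono {i} {suc j} (s≤s i≤j) with m≤n⇒m<n∨m≡n i≤j
... | inj₁ i<j = <-trans (neoB-strictMono i<j) (neoB-<-suc j)
... | inj₂ refl = neoB-<-suc i

neoB-reflect-< : ∀ {i j} → neoB i < neoB j → i < j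
neoB-reflect-< {i} {j} B<B with <-cmp i j
... | tri< i<j _ _ = i<j
... | tri≈ _ refl _ = ⊥-elim (<-irrefl refl B<B)
... | tri> _ _ j<i = ⊥-elim (<-asym B<B (neoB-strictMono j<i))

neoB-isNth : ∀ k → IsNthNeoBC k (neoB k)
neoB-isNth k = neoB-isNeoBC k , applyUpTo neoB k
  , Linked.applyUpTo⁺₂ neoB k neoB-<-suc
  , All.applyUpTo⁺₁ neoB k (λ {i} _ → neoB-isNeoBC i)
  , All.applyUpTo⁺₁ neoB k neoB-strictMono
  , complete
  , length-applyUpTo neoB k
  where
  complete : ∀ j → j < neoB k → NeoBC j → j ∈ applyUpTo neoB k
  complete j j<B isNeoBC = case neoBC⇒≡neoB isNeoBC of λ where
    (i , j≡) → subst (_∈ applyUpTo neoB k) (sym j≡)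
                 (∈-applyUpTo⁺ neoB (neoB-reflect-< {i} {k} (subst (_< neoB k) j≡ j<B)))

neoCR-square : ∀ k → neoCR k * neoCR k ≡ 2 * neoR k * neoR k + 5 * neoR k + 2
neoCR-square k = pell₉⇒CR² {neoCR k} {neoR k} (subst (λ t → Pell₉ (1 + 4 * t) (2 * t + 2 * neoR k + 3)) (neoT≡CR+R+1 k) (pell₉-neoR k))

ℤ-move : ∀ {A B C D : ℤ} → A ℤ.+ B ≡ C ℤ.+ D → A ≡ C ℤ.- B ℤ.+ D
ℤ-move {A} {B} {C} {D} eq = begin
  A              ≡⟨ ℤ-Solver.solve (A ∷ B ∷ []) ⟩
  A ℤ.+ B ℤ.- B  ≡⟨ cong (ℤ._- B) eq ⟩
  C ℤ.+ D ℤ.- B  ≡⟨ ℤ-Solver.solve (B ∷ C ∷ D ∷ []) ⟩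
  C ℤ.- B ℤ.+ D  ∎
  where open ≡-Reasoning

neoC-square : ∀ k → + neoC k ℤ.* + neoC k ≡ + (8 * neoB k * neoB k) ℤ.- + (12 * neoB k) ℤ.+ + 9
neoC-square k = trans (sym (ℤₚ.pos-* (neoC k) (neoC k)))
  (ℤ-move {+ (neoC k * neoC k)} {+ (12 * neoB k)} {+ (8 * neoB k * neoB k)} {+ 9}
    (cong +_ (pell₉⇒C² {neoT k} {neoC k} (pell₉-neo k))))

-- Closed forms in ℤ[√2]

conj : ℤ√2 → ℤ√2
conj ⟨ a , b ⟩ = ⟨ a , - b ⟩

conj-⊗ : ∀ x y → conj (x ⊗ y) ≡ conj x ⊗ conj y
conj-⊗ ⟨ a , b ⟩ ⟨ c , d ⟩ = cong₂ ⟨_,_⟩ re≡ im≡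
  where
  re≡ : a ℤ.* c ℤ.+ + 2 ℤ.* b ℤ.* d ≡ a ℤ.* c ℤ.+ + 2 ℤ.* (- b) ℤ.* (- d)
  re≡ = ℤ-Solver.solve (a ∷ b ∷ c ∷ d ∷ [])
  im≡ : - (a ℤ.* d ℤ.+ b ℤ.* c) ≡ a ℤ.* (- d) ℤ.+ (- b) ℤ.* c
  im≡ = ℤ-Solver.solve (a ∷ b ∷ c ∷ d ∷ [])

β^≡conj-α^ : ∀ n → β ^ n ≡ conj (α ^ n)
β^≡conj-α^ zero = refl
β^≡conj-α^ (suc n) = trans (cong (β ⊗_) (β^≡conj-α^ n)) (sym (conj-⊗ α (α ^ n)))

α⊗ : ∀ a b → α ⊗ ⟨ + a , + b ⟩ ≡ ⟨ + (a + 2 * b) , + (a + b) ⟩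
α⊗ a b = cong₂ ⟨_,_⟩ re≡ im≡
  where
  open ≡-Reasoning
  re≡ : + 1 ℤ.* + a ℤ.+ + 2 ℤ.* + 1 ℤ.* + b ≡ + (a + 2 * b)
  re≡ = begin
    + 1 ℤ.* + a ℤ.+ + 2 ℤ.* + b  ≡⟨ cong₂ ℤ._+_ (ℤₚ.*-identityˡ (+ a)) (sym (ℤₚ.pos-* 2 b)) ⟩
    + a ℤ.+ + (2 * b)            ≡⟨ ℤₚ.pos-+ a (2 * b) ⟨
    + (a + 2 * b)                ∎
  im≡ : + 1 ℤ.* + b ℤ.+ + 1 ℤ.* + a ≡ + (a + b)
  im≡ = begin
    + 1 ℤ.* + b ℤ.+ + 1 ℤ.* + a  ≡⟨ cong₂ ℤ._+_ (ℤₚ.*-identityˡ (+ b)) (ℤₚ.*-identityˡ (+ a)) ⟩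
    + b ℤ.+ + a                  ≡⟨ ℤₚ.+-comm (+ b) (+ a) ⟩
    + a ℤ.+ + b                  ≡⟨ ℤₚ.pos-+ a b ⟨
    + (a + b)                    ∎

α²⊗ : ∀ a b → α ⊗ (α ⊗ ⟨ + a , + b ⟩) ≡ ⟨ + (3 * a + 4 * b) , + (2 * a + 3 * b) ⟩
α²⊗ a b = begin
  α ⊗ (α ⊗ ⟨ + a , + b ⟩)                                  ≡⟨ cong (α ⊗_) (α⊗ a b) ⟩
  α ⊗ ⟨ + (a + 2 * b) , + (a + b) ⟩                         ≡⟨ α⊗ (a + 2 * b) (a + b) ⟩
  ⟨ + (a + 2 * b + 2 * (a + b)) , + (a + 2 * b + (a + b)) ⟩  ≡⟨ cong₂ (λ p q → ⟨ + p , + q ⟩)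
                                                                 (solve (a ∷ b ∷ [])) (solve (a ∷ b ∷ [])) ⟩
  ⟨ + (3 * a + 4 * b) , + (2 * a + 3 * b) ⟩                 ∎
  where open ≡-Reasoning

α⁴⊗ : ∀ a b → α ⊗ (α ⊗ (α ⊗ (α ⊗ ⟨ + a , + b ⟩))) ≡ ⟨ + (17 * a + 24 * b) , + (12 * a + 17 * b) ⟩
α⁴⊗ a b = begin
  α ⊗ (α ⊗ (α ⊗ (α ⊗ ⟨ + a , + b ⟩)))
    ≡⟨ cong (λ z → α ⊗ (α ⊗ z)) (α²⊗ a b) ⟩
  α ⊗ (α ⊗ ⟨ + (3 * a + 4 * b) , + (2 * a + 3 * b) ⟩)
    ≡⟨ α²⊗ (3 * a + 4 * b) (2 * a + 3 * b) ⟩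
  ⟨ + (3 * (3 * a + 4 * b) + 4 * (2 * a + 3 * b)) , + (2 * (3 * a + 4 * b) + 3 * (2 * a + 3 * b)) ⟩
    ≡⟨ cong₂ (λ p q → ⟨ + p , + q ⟩) (solve (a ∷ b ∷ [])) (solve (a ∷ b ∷ [])) ⟩
  ⟨ + (17 * a + 24 * b) , + (12 * a + 17 * b) ⟩
    ∎
  where open ≡-Reasoning

α⁴-step : ∀ a b → α ⊗ (α ⊗ (α ⊗ (α ⊗ ⟨ + (4 * a + 3) , + (2 * b) ⟩)))
                 ≡ ⟨ + (4 * (17 * a + 12 * b + 12) + 3) , + (2 * (24 * a + 17 * b + 18)) ⟩
α⁴-step a b = trans (α⁴⊗ (4 * a + 3) (2 * b)) (cong₂ (λ p q → ⟨ + p , + q ⟩) (solve (a ∷ b ∷ [])) (solve (a ∷ b ∷ [])))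

2+4[1+k]≡4+[2+4k] : ∀ k → 2 + 4 * suc k ≡ 4 + (2 + 4 * k)
2+4[1+k]≡4+[2+4k] k = solve (k ∷ [])

α^[2+4k] : ∀ k → α ^ (2 + 4 * k) ≡ ⟨ + (4 * v k + 3) , + (2 * w k) ⟩
α^[2+4k] zero = refl
α^[2+4k] (suc k) = begin
  α ^ (2 + 4 * suc k)                                       ≡⟨ cong (α ^_) (2+4[1+k]≡4+[2+4k] k) ⟩
  α ^ (4 + (2 + 4 * k))                                     ≡⟨ cong (λ z → α ⊗ (α ⊗ (α ⊗ (α ⊗ z)))) (α^[2+4k] k) ⟩
  α ⊗ (α ⊗ (α ⊗ (α ⊗ ⟨ + (4 * v k + 3) , + (2 * w k) ⟩)))  ≡⟨ α⁴-step (v k) (w k) ⟩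
  ⟨ + (4 * v (suc k) + 3) , + (2 * w (suc k)) ⟩             ∎
  where open ≡-Reasoning

α^[3+4k] : ∀ k → α ^ (3 + 4 * k) ≡ ⟨ + (4 * v k + 3 + 2 * (2 * w k)) , + (4 * v k + 3 + 2 * w k) ⟩
α^[3+4k] k = trans (cong (α ⊗_) (α^[2+4k] k)) (α⊗ (4 * v k + 3) (2 * w k))

trace-form₊ : ∀ {N a} b → + 8 ℤ.* N ≡ + 6 ℤ.* a ℤ.+ + 6 →
              ι (+ 8) ⊗ ι N ≡ ι (+ 3) ⊗ (⟨ a , b ⟩ ⊕ conj ⟨ a , b ⟩) ⊕ ι (+ 6)
trace-form₊ {N} {a} b eq = cong₂ ⟨_,_⟩ re≡ im≡
  where
  open ≡-Reasoning
  re≡ : + 8 ℤ.* N ℤ.+ + 2 ℤ.* + 0 ℤ.* + 0 ≡ + 3 ℤ.* (a ℤ.+ a) ℤ.+ + 2 ℤ.* + 0 ℤ.* (b ℤ.+ - b) ℤ.+ + 6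
  re≡ = begin
    + 8 ℤ.* N ℤ.+ + 2 ℤ.* + 0 ℤ.* + 0                          ≡⟨ ℤ-Solver.solve (N ∷ []) ⟩
    + 8 ℤ.* N                                                   ≡⟨ eq ⟩
    + 6 ℤ.* a ℤ.+ + 6                                           ≡⟨ ℤ-Solver.solve (a ∷ b ∷ []) ⟩
    + 3 ℤ.* (a ℤ.+ a) ℤ.+ + 2 ℤ.* + 0 ℤ.* (b ℤ.+ - b) ℤ.+ + 6  ∎
  im≡ : + 8 ℤ.* + 0 ℤ.+ + 0 ℤ.* N ≡ + 3 ℤ.* (b ℤ.+ - b) ℤ.+ + 0 ℤ.* (a ℤ.+ a) ℤ.+ + 0
  im≡ = ℤ-Solver.solve (N ∷ a ∷ b ∷ [])

trace-form₋ : ∀ {N a} b → + 8 ℤ.* N ℤ.+ + 10 ≡ + 6 ℤ.* a →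
              ι (+ 8) ⊗ ι N ≡ ι (+ 3) ⊗ (⟨ a , b ⟩ ⊕ conj ⟨ a , b ⟩) ⊖ ι (+ 10)
trace-form₋ {N} {a} b eq = cong₂ ⟨_,_⟩ re≡ im≡
  where
  open ≡-Reasoning
  re≡ : + 8 ℤ.* N ℤ.+ + 2 ℤ.* + 0 ℤ.* + 0 ≡ + 3 ℤ.* (a ℤ.+ a) ℤ.+ + 2 ℤ.* + 0 ℤ.* (b ℤ.+ - b) ℤ.- + 10
  re≡ = begin
    + 8 ℤ.* N ℤ.+ + 2 ℤ.* + 0 ℤ.* + 0                           ≡⟨ ℤ-Solver.solve (N ∷ []) ⟩
    + 8 ℤ.* N ℤ.+ + 10 ℤ.- + 10                                  ≡⟨ cong (ℤ._- + 10) eq ⟩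
    + 6 ℤ.* a ℤ.- + 10                                           ≡⟨ ℤ-Solver.solve (a ∷ b ∷ []) ⟩
    + 3 ℤ.* (a ℤ.+ a) ℤ.+ + 2 ℤ.* + 0 ℤ.* (b ℤ.+ - b) ℤ.- + 10  ∎
  im≡ : + 8 ℤ.* + 0 ℤ.+ + 0 ℤ.* N ≡ + 3 ℤ.* (b ℤ.+ - b) ℤ.+ + 0 ℤ.* (a ℤ.+ a) ℤ.- + 0
  im≡ = ℤ-Solver.solve (N ∷ a ∷ b ∷ [])

im-form : ∀ {C N b} a → C ℤ.* N ≡ + 6 ℤ.* b →
          ι C ⊗ √2 ⊗ ι N ≡ ι (+ 3) ⊗ (⟨ a , b ⟩ ⊖ conj ⟨ a , b ⟩)
im-form {C} {N} {b} a eq = cong₂ ⟨_,_⟩ re≡ im≡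
  where
  open ≡-Reasoning
  re≡ : (C ℤ.* + 0 ℤ.+ + 2 ℤ.* + 0 ℤ.* + 1) ℤ.* N ℤ.+ + 2 ℤ.* (C ℤ.* + 1 ℤ.+ + 0 ℤ.* + 0) ℤ.* + 0
      ≡ + 3 ℤ.* (a ℤ.- a) ℤ.+ + 2 ℤ.* + 0 ℤ.* (b ℤ.- - b)
  re≡ = ℤ-Solver.solve (C ∷ N ∷ a ∷ b ∷ [])
  im≡ : (C ℤ.* + 0 ℤ.+ + 2 ℤ.* + 0 ℤ.* + 1) ℤ.* + 0 ℤ.+ (C ℤ.* + 1 ℤ.+ + 0 ℤ.* + 0) ℤ.* N
      ≡ + 3 ℤ.* (b ℤ.- - b) ℤ.+ + 0 ℤ.* (a ℤ.- a)
  im≡ = begin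
    (C ℤ.* + 0 ℤ.+ + 2 ℤ.* + 0 ℤ.* + 1) ℤ.* + 0 ℤ.+ (C ℤ.* + 1 ℤ.+ + 0 ℤ.* + 0) ℤ.* N  ≡⟨ ℤ-Solver.solve (C ∷ N ∷ []) ⟩
    C ℤ.* N                                                                        ≡⟨ eq ⟩
    + 6 ℤ.* b                                                                      ≡⟨ ℤ-Solver.solve (a ∷ b ∷ []) ⟩
    + 3 ℤ.* (b ℤ.- - b) ℤ.+ + 0 ℤ.* (a ℤ.- a)                                      ∎

pos-*+ : ∀ m n c → + (m * n + c) ≡ + m ℤ.* + n ℤ.+ + c
pos-*+ m n c = trans (ℤₚ.pos-+ (m * n) c) (cong (ℤ._+ + c) (ℤₚ.pos-* m n))

4[1+k]∸1≡3+4k : ∀ k → 4 * suc k ∸ 1 ≡ 3 + 4 * k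
4[1+k]∸1≡3+4k k = cong (_∸ 1) (*-suc 4 k)

4[1+k]∸2≡2+4k : ∀ k → 4 * suc k ∸ 2 ≡ 2 + 4 * k
4[1+k]∸2≡2+4k k = cong (_∸ 2) (*-suc 4 k)

α^⊕β^≡ : ∀ n {x} → α ^ n ≡ x → α ^ n ⊕ β ^ n ≡ x ⊕ conj x
α^⊕β^≡ n refl = cong (α ^ n ⊕_) (β^≡conj-α^ n)

α^⊖β^≡ : ∀ n {x} → α ^ n ≡ x → α ^ n ⊖ β ^ n ≡ x ⊖ conj x
α^⊖β^≡ n refl = cong (α ^ n ⊖_) (β^≡conj-α^ n)

neoB-closed-form : ∀ k →
  ι (+ 8) ⊗ ι (+ neoB k) ≡ ι (+ 3) ⊗ (α ^ (4 * suc k ∸ 1) ⊕ β ^ (4 * suc k ∸ 1)) ⊕ ι (+ 6)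
neoB-closed-form k = begin
  ι (+ 8) ⊗ ι (+ neoB k)
    ≡⟨ trace-form₊ {+ neoB k} {+ p} (+ q) (trans (sym (ℤₚ.pos-* 8 (neoB k))) (trans (cong +_ 8B≡) (pos-*+ 6 p 6))) ⟩
  ι (+ 3) ⊗ (⟨ + p , + q ⟩ ⊕ conj ⟨ + p , + q ⟩) ⊕ ι (+ 6)
    ≡⟨ cong (λ z → ι (+ 3) ⊗ z ⊕ ι (+ 6)) (α^⊕β^≡ (3 + 4 * k) (α^[3+4k] k)) ⟨
  ι (+ 3) ⊗ (α ^ (3 + 4 * k) ⊕ β ^ (3 + 4 * k)) ⊕ ι (+ 6)
    ≡⟨ cong (λ n → ι (+ 3) ⊗ (α ^ n ⊕ β ^ n) ⊕ ι (+ 6)) (4[1+k]∸1≡3+4k k) ⟨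
  ι (+ 3) ⊗ (α ^ (4 * suc k ∸ 1) ⊕ β ^ (4 * suc k ∸ 1)) ⊕ ι (+ 6)
    ∎
  where
  open ≡-Reasoning
  p q : ℕ
  p = 4 * v k + 3 + 2 * (2 * w k)
  q = 4 * v k + 3 + 2 * w k
  8B≡ : 8 * neoB k ≡ 6 * p + 6
  8B≡ with v k | w k
  ... | a | b = solve (a ∷ b ∷ [])

neoC-closed-form : ∀ k →
  ι (+ 2) ⊗ √2 ⊗ ι (+ neoC k) ≡ ι (+ 3) ⊗ (α ^ (4 * suc k ∸ 1) ⊖ β ^ (4 * suc k ∸ 1))
neoC-closed-form k = begin
  ι (+ 2) ⊗ √2 ⊗ ι (+ neoC k)
    ≡⟨ im-form {+ 2} {+ neoC k} {+ q} (+ p) (trans (sym (ℤₚ.pos-* 2 (neoC k))) (trans (cong +_ 2C≡) (ℤₚ.pos-* 6 q))) ⟩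
  ι (+ 3) ⊗ (⟨ + p , + q ⟩ ⊖ conj ⟨ + p , + q ⟩)
    ≡⟨ cong (ι (+ 3) ⊗_) (α^⊖β^≡ (3 + 4 * k) (α^[3+4k] k)) ⟨
  ι (+ 3) ⊗ (α ^ (3 + 4 * k) ⊖ β ^ (3 + 4 * k))
    ≡⟨ cong (λ n → ι (+ 3) ⊗ (α ^ n ⊖ β ^ n)) (4[1+k]∸1≡3+4k k) ⟨
  ι (+ 3) ⊗ (α ^ (4 * suc k ∸ 1) ⊖ β ^ (4 * suc k ∸ 1))
    ∎
  where
  open ≡-Reasoning
  p q : ℕ
  p = 4 * v k + 3 + 2 * (2 * w k)
  q = 4 * v k + 3 + 2 * w k
  2C≡ : 2 * neoC k ≡ 6 * q
  2C≡ with v k | w k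
  ... | a | b = solve (a ∷ b ∷ [])

neoR-closed-form : ∀ k →
  ι (+ 8) ⊗ ι (+ neoR k) ≡ ι (+ 3) ⊗ (α ^ (4 * suc k ∸ 2) ⊕ β ^ (4 * suc k ∸ 2)) ⊖ ι (+ 10)
neoR-closed-form k = begin
  ι (+ 8) ⊗ ι (+ neoR k)
    ≡⟨ trace-form₋ {+ neoR k} {+ p} (+ q) (trans (sym (pos-*+ 8 (neoR k) 10)) (trans (cong +_ 8R+10≡) (ℤₚ.pos-* 6 p))) ⟩
  ι (+ 3) ⊗ (⟨ + p , + q ⟩ ⊕ conj ⟨ + p , + q ⟩) ⊖ ι (+ 10)
    ≡⟨ cong (λ z → ι (+ 3) ⊗ z ⊖ ι (+ 10)) (α^⊕β^≡ (2 + 4 * k) (α^[2+4k] k)) ⟨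
  ι (+ 3) ⊗ (α ^ (2 + 4 * k) ⊕ β ^ (2 + 4 * k)) ⊖ ι (+ 10)
    ≡⟨ cong (λ n → ι (+ 3) ⊗ (α ^ n ⊕ β ^ n) ⊖ ι (+ 10)) (4[1+k]∸2≡2+4k k) ⟨
  ι (+ 3) ⊗ (α ^ (4 * suc k ∸ 2) ⊕ β ^ (4 * suc k ∸ 2)) ⊖ ι (+ 10)
    ∎
  where
  open ≡-Reasoning
  p q : ℕ
  p = 4 * v k + 3
  q = 2 * w k
  8R+10≡ : 8 * neoR k + 10 ≡ 6 * p
  8R+10≡ with v k
  ... | a = solve (a ∷ [])

neoCR-closed-form : ∀ k →
  ι (+ 4) ⊗ √2 ⊗ ι (+ neoCR k) ≡ ι (+ 3) ⊗ (α ^ (4 * suc k ∸ 2) ⊖ β ^ (4 * suc k ∸ 2))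
neoCR-closed-form k = begin
  ι (+ 4) ⊗ √2 ⊗ ι (+ neoCR k)
    ≡⟨ im-form {+ 4} {+ neoCR k} {+ q} (+ p) (trans (sym (ℤₚ.pos-* 4 (neoCR k))) (trans (cong +_ 4CR≡) (ℤₚ.pos-* 6 q))) ⟩
  ι (+ 3) ⊗ (⟨ + p , + q ⟩ ⊖ conj ⟨ + p , + q ⟩)
    ≡⟨ cong (ι (+ 3) ⊗_) (α^⊖β^≡ (2 + 4 * k) (α^[2+4k] k)) ⟨
  ι (+ 3) ⊗ (α ^ (2 + 4 * k) ⊖ β ^ (2 + 4 * k))
    ≡⟨ cong (λ n → ι (+ 3) ⊗ (α ^ n ⊖ β ^ n)) (4[1+k]∸2≡2+4k k) ⟨
  ι (+ 3) ⊗ (α ^ (4 * suc k ∸ 2) ⊖ β ^ (4 * suc k ∸ 2))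
    ∎
  where
  open ≡-Reasoning
  p q : ℕ
  p = 4 * v k + 3
  q = 2 * w k
  4CR≡ : 4 * neoCR k ≡ 6 * q
  4CR≡ with w k
  ... | b = solve (b ∷ [])

theorem3p1 : (k : ℕ) → Σ ℕ λ B → IsNthNeoBC k B
    × (ι (+ 8) ⊗ ι (+ B) ≡ ι (+ 3) ⊗ (α ^ (4 * suc k ∸ 1) ⊕ β ^ (4 * suc k ∸ 1)) ⊕ ι (+ 6))
    × (Σ ℕ λ C → (+ C Data.Integer.* + C ≡ + (8 * B * B) Data.Integer.- + (12 * B) Data.Integer.+ + 9)
    × (ι (+ 2) ⊗ √2 ⊗ ι (+ C) ≡ ι (+ 3) ⊗ (α ^ (4 * suc k ∸ 1) ⊖ β ^ (4 * suc k ∸ 1))))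
    × (Σ ℕ λ R → IsNeoBalcobalancer B R
    × (ι (+ 8) ⊗ ι (+ R) ≡ ι (+ 3) ⊗ (α ^ (4 * suc k ∸ 2) ⊕ β ^ (4 * suc k ∸ 2)) ⊖ ι (+ 10))
    × (Σ ℕ λ CR → (CR * CR ≡ 2 * R * R Data.Nat.+ 5 * R Data.Nat.+ 2)
    × (ι (+ 4) ⊗ √2 ⊗ ι (+ CR) ≡ ι (+ 3) ⊗ (α ^ (4 * suc k ∸ 2) ⊖ β ^ (4 * suc k ∸ 2)))))
theorem3p1 k =
  neoB k , neoB-isNth k , neoB-closed-form k ,
  (neoC k , neoC-square k , neoC-closed-form k) ,
  (neoR k , neoR-isNeoBalcobalancer k , neoR-closed-form k ,
    (neoCR k , neoCR-square k , neoCR-closed-form k))
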